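{- The Heyting algebra $(\boldsymbol{D}_2^\infty)^\ast$ belongs to the variety $\mathbb{V}(\boldsymbol{RN})$.
   Context: Heyting algebras are algebras $\langle A;\wedge,\vee,\to,0,1\rangle$. $\boldsymbol{RN}$ is the Rieger–Nishimura lattice, the free one-generated Heyting algebra, and $\mathbb{V}(\boldsymbol{RN})$ is the variety it generates. $\boldsymbol{D}_2$ is the two-element antichain with discrete topology and $\boldsymbol{D}_2^\infty$ is the Esakia space consisting of $\omega$ copies of $\boldsymbol{D}_2$ stacked upwards (each copy above the previous) with a fresh top added; $(\boldsymbol{D}_2^\infty)^\ast$ is its Heyting algebra of clopen upsets, which is isomorphic to the Heyting algebra consisting of $\omega$ copies of the four-element Boolean algebra, each pasted below the previous one (the top of each copy identified with the bottom of the previous one), together with a new bottom element. -}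

module Defs where

open import Level using (Level; _⊔_) renaming (suc to lsuc; zero to lzero)
open import Data.Nat using (ℕ; zero; suc; _<_; _≟_; _<?_)
open import Data.Unit using (⊤)
open import Relation.Nullary using (yes; no)
open import Relation.Binary.PropositionalEquality using (_≡_)

infixr 5 _→ₜ_
infixr 6 _∨ₜ_
infixr 7 _∧ₜ_

data Term (V : Set) : Set where
  var  : V → Term V
  0ₜ   : Term V
  1ₜ   : Term V
  _∧ₜ_ : Term V → Term V → Term V
  _∨ₜ_ : Term V → Term V → Term V
  _→ₜ_ : Term V → Term V → Term V

record HAlg (a ℓ : Level) : Set (lsuc (a ⊔ ℓ)) where
  field
    Carrier : Set a
    _≈_     : Carrier → Carrier → Set ℓ
    zero'   : Carrier
    one'    : Carrier
    meet    : Carrier → Carrier → Carrier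
    join    : Carrier → Carrier → Carrier
    imp     : Carrier → Carrier → Carrier

  eval : {V : Set} → (V → Carrier) → Term V → Carrier
  eval ρ (var x)  = ρ x
  eval ρ 0ₜ       = zero'
  eval ρ 1ₜ       = one'
  eval ρ (s ∧ₜ t) = meet (eval ρ s) (eval ρ t)
  eval ρ (s ∨ₜ t) = join (eval ρ s) (eval ρ t)
  eval ρ (s →ₜ t) = imp  (eval ρ s) (eval ρ t)

_⊨_≈ₑ_ : ∀ {a ℓ} → HAlg a ℓ → Term ℕ → Term ℕ → Set (a ⊔ ℓ)
A ⊨ s ≈ₑ t = ∀ (ρ : ℕ → Carrier) → eval ρ s ≈ eval ρ t
  where open HAlg A

-- B ∈ 𝕍(A): B satisfies every equation valid in A (Birkhoff: 𝕍(A) = Mod(Eq(A)))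
_∈𝕍_ : ∀ {a ℓ b m} → HAlg b m → HAlg a ℓ → Set (a ⊔ ℓ ⊔ b ⊔ m)
B ∈𝕍 A = ∀ (s t : Term ℕ) → A ⊨ s ≈ₑ t → B ⊨ s ≈ₑ t

infix 4 _⊢_≈ₕ_
data _⊢_≈ₕ_ (V : Set) : Term V → Term V → Set where
  refl≈  : ∀ {x} → V ⊢ x ≈ₕ x
  sym≈   : ∀ {x y} → V ⊢ x ≈ₕ y → V ⊢ y ≈ₕ x
  trans≈ : ∀ {x y z} → V ⊢ x ≈ₕ y → V ⊢ y ≈ₕ z → V ⊢ x ≈ₕ z
  ∧-cong : ∀ {x y x' y'} → V ⊢ x ≈ₕ x' → V ⊢ y ≈ₕ y' → V ⊢ x ∧ₜ y ≈ₕ x' ∧ₜ y'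
  ∨-cong : ∀ {x y x' y'} → V ⊢ x ≈ₕ x' → V ⊢ y ≈ₕ y' → V ⊢ x ∨ₜ y ≈ₕ x' ∨ₜ y'
  →-cong : ∀ {x y x' y'} → V ⊢ x ≈ₕ x' → V ⊢ y ≈ₕ y' → V ⊢ x →ₜ y ≈ₕ x' →ₜ y'
  ∧-comm  : ∀ x y → V ⊢ x ∧ₜ y ≈ₕ y ∧ₜ x
  ∨-comm  : ∀ x y → V ⊢ x ∨ₜ y ≈ₕ y ∨ₜ x
  ∧-assoc : ∀ x y z → V ⊢ (x ∧ₜ y) ∧ₜ z ≈ₕ x ∧ₜ (y ∧ₜ z)
  ∨-assoc : ∀ x y z → V ⊢ (x ∨ₜ y) ∨ₜ z ≈ₕ x ∨ₜ (y ∨ₜ z)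
  ∧-idem  : ∀ x → V ⊢ x ∧ₜ x ≈ₕ x
  ∨-idem  : ∀ x → V ⊢ x ∨ₜ x ≈ₕ x
  ∧-absorbs-∨ : ∀ x y → V ⊢ x ∧ₜ (x ∨ₜ y) ≈ₕ x
  ∨-absorbs-∧ : ∀ x y → V ⊢ x ∨ₜ (x ∧ₜ y) ≈ₕ x
  -- distributivity (derivable from the rest, included for convenience)
  ∧-distrib-∨ : ∀ x y z → V ⊢ x ∧ₜ (y ∨ₜ z) ≈ₕ (x ∧ₜ y) ∨ₜ (x ∧ₜ z)
  zero-bot : ∀ x → V ⊢ x ∧ₜ 0ₜ ≈ₕ 0ₜ
  one-top  : ∀ x → V ⊢ x ∨ₜ 1ₜ ≈ₕ 1ₜ
  H1 : ∀ x → V ⊢ x →ₜ x ≈ₕ 1ₜ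
  H2 : ∀ x y → V ⊢ x ∧ₜ (x →ₜ y) ≈ₕ x ∧ₜ y
  H3 : ∀ x y → V ⊢ y ∧ₜ (x →ₜ y) ≈ₕ y
  H4 : ∀ x y z → V ⊢ x →ₜ (y ∧ₜ z) ≈ₕ (x →ₜ y) ∧ₜ (x →ₜ z)

-- RN: the free one-generated Heyting algebra = terms in one variable
-- modulo provable equality in the equational theory of Heyting algebras.

RN : HAlg lzero lzero
RN = record
  { Carrier = Term ⊤
  ; _≈_     = ⊤ ⊢_≈ₕ_
  ; zero'   = 0ₜ
  ; one'    = 1ₜ
  ; meet    = _∧ₜ_
  ; join    = _∨ₜ_
  ; imp     = _→ₜ_
  }

-- (D₂^∞)^* : clopen upsets of D₂^∞.
-- Points of D₂^∞: (k , i) for levels k ∈ ℕ (level k+1 above level k),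
-- i ∈ {L , R}, plus the top point ∞.  The clopen upsets are exactly
--   ⊥D = ∅ ,  ⊤D = the whole space ,  and
--   u n s = {∞} ∪ {levels > n} ∪ s   with s ⊊ level n  (s ∈ {∅, {L}, {R}}).
-- (u n full = u (n-1) ∅, and u 0 full = ⊤D, so this list is irredundant.)

data Side : Set where
  none lft rgt : Side

data D : Set where
  ⊥D : D
  ⊤D : D
  u  : ℕ → Side → D

fullAt : ℕ → D
fullAt zero    = ⊤D
fullAt (suc n) = u n none

side∧ : Side → Side → Side
side∧ none _   = none
side∧ lft lft  = lft
side∧ lft _    = none
side∧ rgt rgt  = rgt
side∧ rgt _    = none

side∨ : ℕ → Side → Side → D
side∨ n none t   = u n t
side∨ n s none   = u n s
side∨ n lft lft  = u n lft
side∨ n rgt rgt  = u n rgt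
side∨ n lft rgt  = fullAt n
side∨ n rgt lft  = fullAt n

compl : Side → Side
compl none = none   -- not used
compl lft  = rgt
compl rgt  = lft

side→ : ℕ → Side → Side → D
side→ n none _   = ⊤D
side→ n lft lft  = ⊤D
side→ n rgt rgt  = ⊤D
side→ n lft _    = u n rgt
side→ n rgt _    = u n lft

meetD : D → D → D
meetD ⊥D _ = ⊥D
meetD _ ⊥D = ⊥D
meetD ⊤D y = y
meetD x ⊤D = x
meetD (u n s) (u m t) with n ≟ m
... | yes _ = u n (side∧ s t)
... | no _ with n <? m
...   | yes _ = u m t
...   | no _  = u n s

joinD : D → D → D
joinD ⊥D y = y
joinD x ⊥D = x
joinD ⊤D _ = ⊤D
joinD _ ⊤D = ⊤D
joinD (u n s) (u m t) with n ≟ m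
... | yes _ = side∨ n s t
... | no _ with n <? m
...   | yes _ = u n s
...   | no _  = u m t

impD : D → D → D
impD ⊥D _ = ⊤D
impD _ ⊤D = ⊤D
impD ⊤D y = y
impD (u n s) ⊥D = ⊥D
impD (u n s) (u m t) with n ≟ m
... | yes _ = side→ n s t
... | no _ with n <? m
...   | yes _ = u m t
...   | no _  = ⊤D

D₂∞* : HAlg lzero lzero
D₂∞* = record
  { Carrier = D
  ; _≈_     = _≡_
  ; zero'   = ⊥D
  ; one'    = ⊤D
  ; meet    = meetD
  ; join    = joinD
  ; imp     = impD
  }

module Submission where

-- Fix an assignment ρ and let K bound the heights of the (finitely many) values
-- ρ x occurring in s and t; the elements of height ≤ K form a subalgebra and are
-- determined by their membership at the "visible" points: the top ∞ and the K
-- bottom levels of D₂^∞.  On the dual side, RN is the algebra of the Kripke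
-- model on the Rieger–Nishimura ladder, and the initial segment of the ladder
-- made of its two top points and K blocks of three points maps onto the visible
-- points by a p-morphism φ.  Every element of height ≤ K is the φ-preimage of
-- the truth set of a term τ K a of RN.  Hence evaluating s at ρ in D₂∞* and
-- reading it at φ n agrees with evaluating s at τ K ∘ ρ in RN and reading it at
-- n; validity of s ≈ t in RN and soundness of the Kripke semantics make the two
-- sides agree at every visible point, so they are equal.

open import Defs
open import Data.Bool using (Bool; true; false; T; T?; not; _∧_; _∨_)
import Data.Bool.Properties as 𝔹
open 𝔹 using (T-∧; T-∨)
open import Algebra.Lattice.Properties.BooleanAlgebra 𝔹.∨-∧-booleanAlgebra using (deMorgan₂)
open import Data.Unit using (⊤; tt)
open import Data.Empty using (⊥; ⊥-elim)
open import Data.Product as × using (∃-syntax; _×_; _,_; proj₁; proj₂)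
open import Data.Sum as ⊎ using (_⊎_; inj₁; inj₂)
open import Data.Nat using (ℕ; zero; suc; pred; _⊔_; _+_; _*_; _∸_; _<_; _≤_; z≤n; s≤s; s<s⁻¹; _<ᵇ_; _≡ᵇ_; _≟_; _<?_)
open import Data.Nat.Properties
  using ( ≤-refl; ≤-trans; <-trans; <-≤-trans; ≤-<-trans; <⇒≤; ≤-reflexive; ≤∧≢⇒<; ≮⇒≥; n<1+n; n≤1+n
        ; m<1+n⇒m<n∨m≡n; <-cmp; <ᵇ⇒<; <⇒<ᵇ; +-identityʳ; +-suc; +-comm; m∸n≤m; m∸[m∸n]≡n; ∸-monoʳ-<
        ; m≤m⊔n; m≤n⊔m; m⊔n≤o⇒m≤o; m⊔n≤o⇒n≤o )
open import Function.Bundles using (Equivalence)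
open Equivalence using (to; from)
open import Relation.Nullary using (yes; no; ¬_)
open import Relation.Nullary.Decidable using (decidable-stable)
open import Relation.Binary.Definitions using (tri<; tri≈; tri>)
open import Relation.Binary.PropositionalEquality
  using (_≡_; _≢_; refl; sym; trans; cong; cong₂; subst; subst₂; module ≡-Reasoning)

_⇒_ : Bool → Bool → Bool
true  ⇒ b = b
false ⇒ _ = true

⇒-intro : ∀ {a b} → (T a → T b) → T (a ⇒ b)
⇒-intro {true}  f = f tt
⇒-intro {false} f = tt

⇒-elim : ∀ {a b} → T (a ⇒ b) → T a → T b
⇒-elim {true} h _ = h

∧-split : ∀ a b → T (a ∧ b) → T a × T b
∧-split a b = T-∧ {a} {b} .to

∧-pair : ∀ a b → T a → T b → T (a ∧ b)
∧-pair a b ta tb = T-∧ {a} {b} .from (ta , tb)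

T-ext : ∀ {a b} → (T a → T b) → (T b → T a) → a ≡ b
T-ext {true}  {true}  _ _ = refl
T-ext {true}  {false} f _ = ⊥-elim (f tt)
T-ext {false} {true}  _ g = ⊥-elim (g tt)
T-ext {false} {false} _ _ = refl

∧-absorbʳ : ∀ a b → (T b → T a) → a ∧ b ≡ b
∧-absorbʳ a true  b⇒a = T-ext (λ _ → tt) (λ _ → ∧-pair a true (b⇒a tt) tt)
∧-absorbʳ a false _   = 𝔹.∧-zeroʳ a

∧-absorbˡ : ∀ a b → (T a → T b) → a ∧ b ≡ a
∧-absorbˡ a b a⇒b = trans (𝔹.∧-comm a b) (∧-absorbʳ b a a⇒b)

∨-absorbʳ : ∀ a b → (T b → T a) → a ∨ b ≡ a
∨-absorbʳ a true  b⇒a = T-ext (λ _ → b⇒a tt) (λ _ → 𝔹.T-∨ {a} .from (inj₂ tt))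
∨-absorbʳ a false _   = 𝔹.∨-identityʳ a

∨-absorbˡ : ∀ a b → (T a → T b) → a ∨ b ≡ b
∨-absorbˡ a b a⇒b = trans (𝔹.∨-comm a b) (∨-absorbʳ b a a⇒b)

record DecidableFrame : Set₁ where
  field
    World       : Set
    _≼_         : World → World → Set
    ≼-refl      : ∀ {w} → w ≼ w
    ≼-trans     : ∀ {u v w} → u ≼ v → v ≼ w → u ≼ w
    every       : World → (World → Bool) → Bool
    every-intro : ∀ {w} P → (∀ {v} → w ≼ v → T (P v)) → T (every w P)
    every-elim  : ∀ {w} P → T (every w P) → ∀ {v} → w ≼ v → T (P v)

  every-cong : ∀ {w} P Q → (∀ {v} → w ≼ v → P v ≡ Q v) → every w P ≡ every w Q
  every-cong P Q P≡Q =
    T-ext (λ p → every-intro Q (λ r → subst T (P≡Q r) (every-elim P p r)))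
          (λ q → every-intro P (λ r → subst T (sym (P≡Q r)) (every-elim Q q r)))

  every-⇒-intro : ∀ {w} p q → (∀ {v} → w ≼ v → T (p v) → T (q v)) → T (every w (λ v → p v ⇒ q v))
  every-⇒-intro p q f = every-intro (λ v → p v ⇒ q v) (λ {v} r → ⇒-intro {p v} (f r))

  every-⇒-elim : ∀ {w} p q → T (every w (λ v → p v ⇒ q v)) → ∀ {v} → w ≼ v → T (p v) → T (q v)
  every-⇒-elim p q h {v} r = ⇒-elim {p v} (every-elim (λ v → p v ⇒ q v) h r)

  Persistent : (World → Bool) → Set
  Persistent p = ∀ {v w} → v ≼ w → T (p v) → T (p w)

  every-⇒-refl : ∀ {w} p → every w (λ v → p v ⇒ p v) ≡ true
  every-⇒-refl p = T-ext (λ _ → tt) (λ _ → every-⇒-intro p p (λ _ h → h))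

  every-⇒-mp : ∀ {w} p q → Persistent q → p w ∧ every w (λ v → p v ⇒ q v) ≡ p w ∧ q w
  every-⇒-mp {w} p q q-persists = T-ext
    (λ h → let (pw , p⇒q) = ∧-split (p w) _ h in ∧-pair (p w) (q w) pw (every-⇒-elim p q p⇒q ≼-refl pw))
    (λ h → let (pw , qw) = ∧-split (p w) (q w) h in
           ∧-pair (p w) _ pw (every-⇒-intro p q (λ r _ → q-persists r qw)))

  every-⇒-absorb : ∀ {w} p q → Persistent q → q w ∧ every w (λ v → p v ⇒ q v) ≡ q w
  every-⇒-absorb {w} p q q-persists = T-ext
    (λ h → proj₁ (∧-split (q w) _ h))
    (λ qw → ∧-pair (q w) _ qw (every-⇒-intro p q (λ r _ → q-persists r qw)))

  every-⇒-∧ : ∀ {w} p q r → every w (λ v → p v ⇒ (q v ∧ r v))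
                           ≡ every w (λ v → p v ⇒ q v) ∧ every w (λ v → p v ⇒ r v)
  every-⇒-∧ {w} p q r = T-ext
    (λ h → ∧-pair (every w (λ v → p v ⇒ q v)) _
             (every-⇒-intro p q (λ s pv → proj₁ (∧-split (q _) (r _) (every-⇒-elim p _ h s pv))))
             (every-⇒-intro p r (λ s pv → proj₂ (∧-split (q _) (r _) (every-⇒-elim p _ h s pv)))))
    (λ h → let (pq , pr) = ∧-split (every w (λ v → p v ⇒ q v)) _ h in
           every-⇒-intro p (λ v → q v ∧ r v) (λ s pv →
             ∧-pair (q _) (r _) (every-⇒-elim p q pq s pv) (every-⇒-elim p r pr s pv)))

module KripkeSemantics (F : DecidableFrame) {V : Set} (val : V → DecidableFrame.World F → Bool)
       (val-persists : ∀ x {v w} → DecidableFrame._≼_ F v w → T (val x v) → T (val x w)) where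
  open DecidableFrame F

  sat : World → Term V → Bool
  sat w (var x)  = val x w
  sat w 0ₜ       = false
  sat w 1ₜ       = true
  sat w (a ∧ₜ b) = sat w a ∧ sat w b
  sat w (a ∨ₜ b) = sat w a ∨ sat w b
  sat w (a →ₜ b) = every w (λ v → sat v a ⇒ sat v b)

  persists : ∀ t {v w} → v ≼ w → T (sat v t) → T (sat w t)
  persists (var x)  r h = val-persists x r h
  persists 1ₜ       r h = tt
  persists (a ∧ₜ b) r h = T-∧ .from (×.map (persists a r) (persists b r) (T-∧ {sat _ a} .to h))
  persists (a ∨ₜ b) r h = T-∨ .from (⊎.map (persists a r) (persists b r) (T-∨ {sat _ a} .to h))
  persists (a →ₜ b) r h = every-intro _ (λ r' → every-elim _ h (≼-trans r r'))

  sound : ∀ {a b} → V ⊢ a ≈ₕ b → ∀ w → sat w a ≡ sat w b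
  sound refl≈                 w = refl
  sound (sym≈ p)              w = sym (sound p w)
  sound (trans≈ p q)          w = trans (sound p w) (sound q w)
  sound (∧-cong p q)          w = cong₂ _∧_ (sound p w) (sound q w)
  sound (∨-cong p q)          w = cong₂ _∨_ (sound p w) (sound q w)
  sound (→-cong p q)          w = every-cong _ _ (λ {v} _ → cong₂ _⇒_ (sound p v) (sound q v))
  sound (∧-comm x y)          w = 𝔹.∧-comm (sat w x) (sat w y)
  sound (∨-comm x y)          w = 𝔹.∨-comm (sat w x) (sat w y)
  sound (∧-assoc x y z)       w = 𝔹.∧-assoc (sat w x) (sat w y) (sat w z)
  sound (∨-assoc x y z)       w = 𝔹.∨-assoc (sat w x) (sat w y) (sat w z)
  sound (∧-idem x)            w = 𝔹.∧-idem (sat w x)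
  sound (∨-idem x)            w = 𝔹.∨-idem (sat w x)
  sound (∧-absorbs-∨ x y)     w = 𝔹.∧-abs-∨ (sat w x) (sat w y)
  sound (∨-absorbs-∧ x y)     w = 𝔹.∨-abs-∧ (sat w x) (sat w y)
  sound (∧-distrib-∨ x y z)   w = 𝔹.∧-distribˡ-∨ (sat w x) (sat w y) (sat w z)
  sound (zero-bot x)          w = 𝔹.∧-zeroʳ (sat w x)
  sound (one-top x)           w = 𝔹.∨-zeroʳ (sat w x)
  sound (H1 x)                w = every-⇒-refl (λ v → sat v x)
  sound (H2 x y)              w = every-⇒-mp (λ v → sat v x) (λ v → sat v y) (persists y)
  sound (H3 x y)              w = every-⇒-absorb (λ v → sat v x) (λ v → sat v y) (persists y)
  sound (H4 x y z)            w = every-⇒-∧ (λ v → sat v x) (λ v → sat v y) (λ v → sat v z)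

-- The Rieger–Nishimura ladder, the Esakia dual of RN: its points are the
-- naturals, and n sees itself and every m with m + 2 ≤ n, so 0 and 1 are maximal.

allBelow : ℕ → (ℕ → Bool) → Bool
allBelow zero    P = true
allBelow (suc k) P = P k ∧ allBelow k P

allBelow-intro : ∀ k P → (∀ {m} → m < k → T (P m)) → T (allBelow k P)
allBelow-intro zero    P h = tt
allBelow-intro (suc k) P h = ∧-pair (P k) _ (h (n<1+n k)) (allBelow-intro k P (λ m<k → h (<-trans m<k (n<1+n k))))

allBelow-elim : ∀ k P → T (allBelow k P) → ∀ {m} → m < k → T (P m)
allBelow-elim (suc k) P h m<sk with m<1+n⇒m<n∨m≡n m<sk
... | inj₁ m<k  = allBelow-elim k P (proj₂ (∧-split (P k) _ h)) m<k
... | inj₂ refl = proj₁ (∧-split (P k) _ h)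

_⊑_ : ℕ → ℕ → Set
n ⊑ m = m ≡ n ⊎ suc m < n

⊑-trans : ∀ {k m n} → k ⊑ m → m ⊑ n → k ⊑ n
⊑-trans (inj₁ refl) m⊑n            = m⊑n
⊑-trans k⊑m         (inj₁ refl)    = k⊑m
⊑-trans (inj₂ m<k)  (inj₂ n<m)     = inj₂ (<-trans n<m (<-trans (n<1+n _) m<k))

ladder : DecidableFrame
ladder = record
  { World       = ℕ
  ; _≼_         = _⊑_
  ; ≼-refl      = inj₁ refl
  ; ≼-trans     = ⊑-trans
  ; every       = λ n P → P n ∧ allBelow (pred n) P
  ; every-intro = intro
  ; every-elim  = elim
  }
  where
  intro : ∀ {n} P → (∀ {m} → n ⊑ m → T (P m)) → T (P n ∧ allBelow (pred n) P)
  intro {n} P h = ∧-pair (P n) _ (h (inj₁ refl)) (allBelow-intro (pred n) P (λ m<n-1 → h (inj₂ (<pred⇒1+< n m<n-1))))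
    where
    <pred⇒1+< : ∀ n {m} → m < pred n → suc m < n
    <pred⇒1+< (suc n) m<n = s≤s m<n

  elim : ∀ {n} P → T (P n ∧ allBelow (pred n) P) → ∀ {m} → n ⊑ m → T (P m)
  elim {n} P h (inj₁ refl)  = proj₁ (∧-split (P n) _ h)
  elim {suc n} P h (inj₂ m<n) = allBelow-elim n P (proj₂ (∧-split (P (suc n)) _ h)) (s<s⁻¹ m<n)

generator-persists : ∀ {n m} → n ⊑ m → T (n ≡ᵇ 0) → T (m ≡ᵇ 0)
generator-persists (inj₁ refl) h = h
generator-persists {zero} (inj₂ ()) h

open KripkeSemantics ladder {⊤} (λ _ n → n ≡ᵇ 0) (λ _ → generator-persists)

-- Definable subsets of the ladder: `below b` holds exactly on {n | n < b},
-- and `gap b` exactly on {n | n < b} ∪ {b + 1}.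
below : ℕ → Term ⊤
below zero          = 0ₜ
below (suc zero)    = var tt
below (suc (suc b)) = below (suc b) ∨ₜ (below (suc b) →ₜ below b)

gap : ℕ → Term ⊤
gap b = below (suc b) →ₜ below b

<ᵇ-suc : ∀ n b → (n <ᵇ suc b) ≡ (n <ᵇ b) ∨ (n ≡ᵇ b)
<ᵇ-suc zero    zero    = refl
<ᵇ-suc zero    (suc b) = refl
<ᵇ-suc (suc n) zero    = refl
<ᵇ-suc (suc n) (suc b) = <ᵇ-suc n b

≡ᵇ-sym : ∀ m n → (m ≡ᵇ n) ≡ (n ≡ᵇ m)
≡ᵇ-sym zero    zero    = refl
≡ᵇ-sym zero    (suc n) = refl
≡ᵇ-sym (suc m) zero    = refl
≡ᵇ-sym (suc m) (suc n) = ≡ᵇ-sym m n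

⇒-<ᵇ-suc : ∀ m b → (m <ᵇ suc b) ⇒ (m <ᵇ b) ≡ not (m ≡ᵇ b)
⇒-<ᵇ-suc zero    zero    = refl
⇒-<ᵇ-suc zero    (suc b) = refl
⇒-<ᵇ-suc (suc m) zero    = refl
⇒-<ᵇ-suc (suc m) (suc b) = ⇒-<ᵇ-suc m b

allBelow-≢ : ∀ k b → allBelow k (λ m → not (m ≡ᵇ b)) ≡ not (b <ᵇ k)
allBelow-≢ zero    b = refl
allBelow-≢ (suc k) b = begin
  not (k ≡ᵇ b) ∧ allBelow k (λ m → not (m ≡ᵇ b))  ≡⟨ cong₂ (λ x y → not x ∧ y) (≡ᵇ-sym k b) (allBelow-≢ k b) ⟩
  not (b ≡ᵇ k) ∧ not (b <ᵇ k)                      ≡⟨ sym (deMorgan₂ (b ≡ᵇ k) (b <ᵇ k)) ⟩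
  not ((b ≡ᵇ k) ∨ (b <ᵇ k))                          ≡⟨ cong not (trans (𝔹.∨-comm (b ≡ᵇ k) (b <ᵇ k)) (sym (<ᵇ-suc b k))) ⟩
  not (b <ᵇ suc k)                                 ∎
  where open ≡-Reasoning

gap-shape : ∀ n b → not (n ≡ᵇ b) ∧ not (b <ᵇ pred n) ≡ (n <ᵇ b) ∨ (n ≡ᵇ suc b)
gap-shape zero                zero          = refl
gap-shape zero                (suc b)       = refl
gap-shape (suc zero)          zero          = refl
gap-shape (suc zero)          (suc zero)    = refl
gap-shape (suc zero)          (suc (suc b)) = refl
gap-shape (suc (suc n))       zero          = refl
gap-shape (suc (suc n))       (suc b)       = gap-shape (suc n) b

<ᵇ-suc-absorbs : ∀ n b → (n <ᵇ suc b) ∨ (n <ᵇ b) ≡ (n <ᵇ suc b)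
<ᵇ-suc-absorbs zero    zero    = refl
<ᵇ-suc-absorbs zero    (suc b) = refl
<ᵇ-suc-absorbs (suc n) zero    = refl
<ᵇ-suc-absorbs (suc n) (suc b) = <ᵇ-suc-absorbs n b

open DecidableFrame ladder using (every-cong)

sat-gap-from : ∀ b → (∀ n → sat n (below (suc b)) ≡ (n <ᵇ suc b)) → (∀ n → sat n (below b) ≡ (n <ᵇ b)) →
               ∀ n → sat n (gap b) ≡ (n <ᵇ b) ∨ (n ≡ᵇ suc b)
sat-gap-from b below-b+1 below-b n = begin
  sat n (gap b)
    ≡⟨ every-cong _ _ (λ {m} _ → trans (cong₂ _⇒_ (below-b+1 m) (below-b m)) (⇒-<ᵇ-suc m b)) ⟩
  not (n ≡ᵇ b) ∧ allBelow (pred n) (λ m → not (m ≡ᵇ b))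
    ≡⟨ cong (not (n ≡ᵇ b) ∧_) (allBelow-≢ (pred n) b) ⟩
  not (n ≡ᵇ b) ∧ not (b <ᵇ pred n)
    ≡⟨ gap-shape n b ⟩
  (n <ᵇ b) ∨ (n ≡ᵇ suc b) ∎
  where open ≡-Reasoning

sat-below : ∀ b n → sat n (below b) ≡ (n <ᵇ b)
sat-below zero          n       = refl
sat-below (suc zero)    zero    = refl
sat-below (suc zero)    (suc n) = refl
sat-below (suc (suc b)) n       = begin
  sat n (below (suc b)) ∨ sat n (gap b)
    ≡⟨ cong₂ _∨_ (sat-below (suc b) n) (sat-gap-from b (sat-below (suc b)) (sat-below b) n) ⟩
  (n <ᵇ suc b) ∨ ((n <ᵇ b) ∨ (n ≡ᵇ suc b))
    ≡⟨ sym (𝔹.∨-assoc (n <ᵇ suc b) (n <ᵇ b) (n ≡ᵇ suc b)) ⟩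
  ((n <ᵇ suc b) ∨ (n <ᵇ b)) ∨ (n ≡ᵇ suc b)
    ≡⟨ cong (_∨ (n ≡ᵇ suc b)) (<ᵇ-suc-absorbs n b) ⟩
  (n <ᵇ suc b) ∨ (n ≡ᵇ suc b)
    ≡⟨ sym (<ᵇ-suc n (suc b)) ⟩
  (n <ᵇ suc (suc b)) ∎
  where open ≡-Reasoning

sat-gap : ∀ b n → sat n (gap b) ≡ (n <ᵇ b) ∨ (n ≡ᵇ suc b)
sat-gap b = sat-gap-from b (sat-below (suc b)) (sat-below b)

-- Comparison of levels, as a three-way case distinction that computes.
data Cmp : Set where
  LT EQ GT : Cmp

cmp : ℕ → ℕ → Cmp
cmp zero    zero    = EQ
cmp zero    (suc _) = LT
cmp (suc _) zero    = GT
cmp (suc m) (suc n) = cmp m n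

by-cmp : {A : Set} → Cmp → A → A → A → A
by-cmp LT a _ _ = a
by-cmp EQ _ b _ = b
by-cmp GT _ _ c = c

cmp-< : ∀ {m n} → m < n → cmp m n ≡ LT
cmp-< {zero}  (s≤s _)   = refl
cmp-< {suc m} (s≤s m<n) = cmp-< m<n

cmp-refl : ∀ n → cmp n n ≡ EQ
cmp-refl zero    = refl
cmp-refl (suc n) = cmp-refl n

cmp-> : ∀ {m n} → n < m → cmp m n ≡ GT
cmp-> {suc m} {zero}  _         = refl
cmp-> {suc m} {suc n} (s≤s n<m) = cmp-> n<m

cmp-LT : ∀ m n → cmp m n ≡ LT → m < n
cmp-LT zero    (suc n) _ = s≤s z≤n
cmp-LT (suc m) (suc n) e = s≤s (cmp-LT m n e)

cmp-EQ : ∀ m n → cmp m n ≡ EQ → m ≡ n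
cmp-EQ zero    zero    _ = refl
cmp-EQ (suc m) (suc n) e = cong suc (cmp-EQ m n e)

cmp-GT : ∀ m n → cmp m n ≡ GT → n < m
cmp-GT (suc m) zero    _ = s≤s z≤n
cmp-GT (suc m) (suc n) e = s≤s (cmp-GT m n e)

≢∧≮⇒> : ∀ {n m} → n ≢ m → ¬ n < m → m < n
≢∧≮⇒> n≢m n≮m = ≤∧≢⇒< (≮⇒≥ n≮m) (λ m≡n → n≢m (sym m≡n))

meetD-u : ∀ n s m t → meetD (u n s) (u m t) ≡ by-cmp (cmp n m) (u m t) (u n (side∧ s t)) (u n s)
meetD-u n s m t with n ≟ m
... | yes refl rewrite cmp-refl n = refl
... | no n≢m with n <? m
...   | yes n<m rewrite cmp-< n<m = refl
...   | no n≮m  rewrite cmp-> (≢∧≮⇒> n≢m n≮m) = refl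

joinD-u : ∀ n s m t → joinD (u n s) (u m t) ≡ by-cmp (cmp n m) (u n s) (side∨ n s t) (u m t)
joinD-u n s m t with n ≟ m
... | yes refl rewrite cmp-refl n = refl
... | no n≢m with n <? m
...   | yes n<m rewrite cmp-< n<m = refl
...   | no n≮m  rewrite cmp-> (≢∧≮⇒> n≢m n≮m) = refl

impD-u : ∀ n s m t → impD (u n s) (u m t) ≡ by-cmp (cmp n m) (u m t) (side→ n s t) ⊤D
impD-u n s m t with n ≟ m
... | yes refl rewrite cmp-refl n = refl
... | no n≢m with n <? m
...   | yes n<m rewrite cmp-< n<m = refl
...   | no n≮m  rewrite cmp-> (≢∧≮⇒> n≢m n≮m) = refl

data LR : Set where
  L R : LR

data Point : Set where
  ∞  : Point
  pt : ℕ → LR → Point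

_≤ₚ_ : Point → Point → Set
_        ≤ₚ ∞        = ⊤
∞        ≤ₚ pt _ _   = ⊥
pt l x   ≤ₚ pt l' y  = l < l' ⊎ (l ≡ l' × x ≡ y)

≤ₚ-refl : ∀ p → p ≤ₚ p
≤ₚ-refl ∞        = tt
≤ₚ-refl (pt l x) = inj₂ (refl , refl)

_∈ˢ_ : LR → Side → Bool
_ ∈ˢ none = false
L ∈ˢ lft  = true
R ∈ˢ lft  = false
L ∈ˢ rgt  = false
R ∈ˢ rgt  = true

infix 9 _∈_
_∈_ : Point → D → Bool
_      ∈ ⊥D    = false
_      ∈ ⊤D    = true
∞      ∈ u _ _ = true
pt l x ∈ u n s = by-cmp (cmp n l) true (x ∈ˢ s) false

∈u⇒level≥ : ∀ {n l x s} → T (pt l x ∈ u n s) → n ≤ l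
∈u⇒level≥ {n} {l} h with cmp n l in e
... | LT = <⇒≤ (cmp-LT n l e)
... | EQ = ≤-reflexive (cmp-EQ n l e)

u-antitone : ∀ {n m} s t p → n < m → T (p ∈ u m t) → T (p ∈ u n s)
u-antitone s t ∞        n<m h = tt
u-antitone {m = m} s t (pt l x) n<m h rewrite cmp-< (<-≤-trans n<m (∈u⇒level≥ {m} {l} {x} {t} h)) = tt

∈-upset : ∀ a {p q} → p ≤ₚ q → T (p ∈ a) → T (q ∈ a)
∈-upset ⊤D      _                     h = tt
∈-upset (u n s) {q = ∞}               _ h = tt
∈-upset (u n s) {pt l x} {pt l' y} (inj₂ (refl , refl)) h = h
∈-upset (u n s) {pt l x} {pt l' y} (inj₁ l<l') h
  rewrite cmp-< (≤-<-trans (∈u⇒level≥ {n} {l} {x} {s} h) l<l') = tt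

∈ˢ-∧ : ∀ x s t → x ∈ˢ side∧ s t ≡ (x ∈ˢ s) ∧ (x ∈ˢ t)
∈ˢ-∧ x none t    = refl
∈ˢ-∧ L  lft  none = refl
∈ˢ-∧ L  lft  lft  = refl
∈ˢ-∧ L  lft  rgt  = refl
∈ˢ-∧ R  lft  none = refl
∈ˢ-∧ R  lft  lft  = refl
∈ˢ-∧ R  lft  rgt  = refl
∈ˢ-∧ L  rgt  none = refl
∈ˢ-∧ L  rgt  lft  = refl
∈ˢ-∧ L  rgt  rgt  = refl
∈ˢ-∧ R  rgt  none = refl
∈ˢ-∧ R  rgt  lft  = refl
∈ˢ-∧ R  rgt  rgt  = refl

∈-u-side∧ : ∀ p n s t → p ∈ u n (side∧ s t) ≡ (p ∈ u n s) ∧ (p ∈ u n t)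
∈-u-side∧ ∞        n s t = refl
∈-u-side∧ (pt l x) n s t with cmp n l
... | LT = refl
... | EQ = ∈ˢ-∧ x s t
... | GT = refl

∈-meet : ∀ p a b → p ∈ meetD a b ≡ (p ∈ a) ∧ (p ∈ b)
∈-meet p ⊥D      b        = refl
∈-meet p ⊤D      ⊥D       = refl
∈-meet p ⊤D      ⊤D       = refl
∈-meet p ⊤D      (u m t)  = refl
∈-meet p (u n s) ⊥D       = sym (𝔹.∧-zeroʳ (p ∈ u n s))
∈-meet p (u n s) ⊤D       = sym (𝔹.∧-identityʳ (p ∈ u n s))
∈-meet p (u n s) (u m t) rewrite meetD-u n s m t with cmp n m in e
... | LT = sym (∧-absorbʳ (p ∈ u n s) (p ∈ u m t) (u-antitone s t p (cmp-LT n m e)))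
... | GT = sym (∧-absorbˡ (p ∈ u n s) (p ∈ u m t) (u-antitone t s p (cmp-GT n m e)))
... | EQ with refl ← cmp-EQ n m e = ∈-u-side∧ p n s t

∈-fullAt : ∀ l x n → pt l x ∈ fullAt n ≡ by-cmp (cmp n l) true true false
∈-fullAt zero    x zero    = refl
∈-fullAt (suc l) x zero    = refl
∈-fullAt l       x (suc n) = n<l⇔1+n≤l n l
  where
  n<l⇔1+n≤l : ∀ n l → by-cmp (cmp n l) true false false ≡ by-cmp (cmp (suc n) l) true true false
  n<l⇔1+n≤l zero    zero          = refl
  n<l⇔1+n≤l zero    (suc zero)    = refl
  n<l⇔1+n≤l zero    (suc (suc l)) = refl
  n<l⇔1+n≤l (suc n) zero          = refl
  n<l⇔1+n≤l (suc n) (suc l)       = n<l⇔1+n≤l n l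

by-cmp-∨ : ∀ c a b → by-cmp c true a false ∨ by-cmp c true b false ≡ by-cmp c true (a ∨ b) false
by-cmp-∨ LT a b = refl
by-cmp-∨ EQ a b = refl
by-cmp-∨ GT a b = refl

∈-side∨ : ∀ l x n s t → pt l x ∈ side∨ n s t ≡ by-cmp (cmp n l) true ((x ∈ˢ s) ∨ (x ∈ˢ t)) false
∈-side∨ l x n none t    = refl
∈-side∨ l L n lft  none = refl
∈-side∨ l R n lft  none = refl
∈-side∨ l L n rgt  none = refl
∈-side∨ l R n rgt  none = refl
∈-side∨ l L n lft  lft  = refl
∈-side∨ l R n lft  lft  = refl
∈-side∨ l L n rgt  rgt  = refl
∈-side∨ l R n rgt  rgt  = refl
∈-side∨ l L n lft  rgt  = ∈-fullAt l L n
∈-side∨ l R n lft  rgt  = ∈-fullAt l R n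
∈-side∨ l L n rgt  lft  = ∈-fullAt l L n
∈-side∨ l R n rgt  lft  = ∈-fullAt l R n

∞∈fullAt : ∀ n → T (∞ ∈ fullAt n)
∞∈fullAt zero    = tt
∞∈fullAt (suc n) = tt

∞∈side∨ : ∀ n s t → ∞ ∈ side∨ n s t ≡ true
∞∈side∨ n none t    = refl
∞∈side∨ n lft  none = refl
∞∈side∨ n rgt  none = refl
∞∈side∨ n lft  lft  = refl
∞∈side∨ n rgt  rgt  = refl
∞∈side∨ n lft  rgt  = T-ext (λ _ → tt) (λ _ → ∞∈fullAt n)
∞∈side∨ n rgt  lft  = T-ext (λ _ → tt) (λ _ → ∞∈fullAt n)

∈-join : ∀ p a b → p ∈ joinD a b ≡ (p ∈ a) ∨ (p ∈ b)
∈-join p ⊥D      b        = refl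
∈-join p ⊤D      ⊥D       = refl
∈-join p ⊤D      ⊤D       = refl
∈-join p ⊤D      (u m t)  = refl
∈-join p (u n s) ⊥D       = sym (𝔹.∨-identityʳ (p ∈ u n s))
∈-join p (u n s) ⊤D       = sym (𝔹.∨-zeroʳ (p ∈ u n s))
∈-join p (u n s) (u m t) rewrite joinD-u n s m t with cmp n m in e
... | LT = sym (∨-absorbʳ (p ∈ u n s) (p ∈ u m t) (u-antitone s t p (cmp-LT n m e)))
... | GT = sym (∨-absorbˡ (p ∈ u n s) (p ∈ u m t) (u-antitone t s p (cmp-GT n m e)))
... | EQ with refl ← cmp-EQ n m e with p
...   | ∞      = ∞∈side∨ n s t
...   | pt l x = trans (∈-side∨ l x n s t) (sym (by-cmp-∨ (cmp n l) (x ∈ˢ s) (x ∈ˢ t)))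

above-both-sides : ∀ {l x n} t → T (pt l x ∈ u n lft) → T (pt l x ∈ u n rgt) → T (pt l x ∈ u n t)
above-both-sides {l} {L} {n} t h₁ h₂ with cmp n l
... | LT = tt
above-both-sides {l} {R} {n} t h₁ h₂ with cmp n l
... | LT = tt

∈-side→-elim : ∀ l x n s t → T (pt l x ∈ side→ n s t) → T (pt l x ∈ u n s) → T (pt l x ∈ u n t)
∈-side→-elim l x n none t    _ h with cmp n l
... | LT = tt
∈-side→-elim l x n lft  lft  _ h = h
∈-side→-elim l x n rgt  rgt  _ h = h
∈-side→-elim l x n lft  rgt  h _ = h
∈-side→-elim l x n rgt  lft  h _ = h
∈-side→-elim l x n lft  none h h' = above-both-sides {l} {x} {n} none h' h
∈-side→-elim l x n rgt  none h h' = above-both-sides {l} {x} {n} none h h'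

∈-imp-elim : ∀ p a b → T (p ∈ impD a b) → T (p ∈ a) → T (p ∈ b)
∈-imp-elim p ⊤D      ⊥D      h _ = h
∈-imp-elim p ⊤D      ⊤D      h _ = tt
∈-imp-elim p ⊤D      (u m t) h _ = h
∈-imp-elim p (u n s) ⊥D      h _ = h
∈-imp-elim p (u n s) ⊤D      h _ = tt
∈-imp-elim p (u n s) (u m t) h h' rewrite impD-u n s m t with cmp n m in e
... | LT = h
... | GT = u-antitone t s p (cmp-GT n m e) h'
... | EQ with refl ← cmp-EQ n m e with p
...   | ∞      = tt
...   | pt l x = ∈-side→-elim l x n s t h h'

notIn : Side → LR
notIn none = L
notIn lft  = R
notIn rgt  = L

notIn-∉ : ∀ s → ¬ T (notIn s ∈ˢ s)
notIn-∉ none ()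
notIn-∉ lft  ()
notIn-∉ rgt  ()

∉u⇒below : ∀ {n l x} s → ¬ T (pt l x ∈ u n s) → l < n ⊎ (l ≡ n × ¬ T (x ∈ˢ s))
∉u⇒below {n} {l} s h with cmp n l in e
... | LT = ⊥-elim (h tt)
... | EQ = inj₂ (sym (cmp-EQ n l e) , h)
... | GT = inj₁ (cmp-GT n l e)

Witness : Point → D → D → Set
Witness p a b = ∃[ q ] p ≤ₚ q × T (q ∈ a) × ¬ T (q ∈ b)

notIn-∉u : ∀ m t → ¬ T (pt m (notIn t) ∈ u m t)
notIn-∉u m t rewrite cmp-refl m = notIn-∉ t

level-witness : ∀ {n m} s t → n < m → T (pt m (notIn t) ∈ u n s) × ¬ T (pt m (notIn t) ∈ u m t)
level-witness {n} {m} s t n<m rewrite cmp-< n<m = tt , notIn-∉u m t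

∈-u-at-level : ∀ n y s → pt n y ∈ u n s ≡ y ∈ˢ s
∈-u-at-level n y s rewrite cmp-refl n = refl

sideOf : LR → Side
sideOf L = lft
sideOf R = rgt

opposite : LR → LR
opposite L = R
opposite R = L

∉-opposite⇒≤ : ∀ {l x n} y → ¬ T (pt l x ∈ u n (sideOf (opposite y))) → pt l x ≤ₚ pt n y
∉-opposite⇒≤ {x = x} y h with ∉u⇒below (sideOf (opposite y)) h
... | inj₁ l<n          = inj₁ l<n
... | inj₂ (refl , x∉) = inj₂ (refl , same-side x y x∉)
  where
  same-side : ∀ x y → ¬ T (x ∈ˢ sideOf (opposite y)) → x ≡ y
  same-side L L _ = refl
  same-side R R _ = refl
  same-side L R h = ⊥-elim (h tt)
  same-side R L h = ⊥-elim (h tt)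

level-n-witness : ∀ {p n} y s t → p ≤ₚ pt n y → T (y ∈ˢ s) → ¬ T (y ∈ˢ t) → Witness p (u n s) (u n t)
level-n-witness {n = n} y s t p≤ y∈s y∉t =
  pt n y , p≤ , subst T (sym (∈-u-at-level n y s)) y∈s , λ h → y∉t (subst T (∈-u-at-level n y t) h)

side→-witness : ∀ n p s t → ¬ T (p ∈ side→ n s t) → Witness p (u n s) (u n t)
side→-witness n p        none t    h = ⊥-elim (h tt)
side→-witness n p        lft  lft  h = ⊥-elim (h tt)
side→-witness n p        rgt  rgt  h = ⊥-elim (h tt)
side→-witness n ∞        lft  none h = ⊥-elim (h tt)
side→-witness n ∞        lft  rgt  h = ⊥-elim (h tt)
side→-witness n ∞        rgt  none h = ⊥-elim (h tt)
side→-witness n ∞        rgt  lft  h = ⊥-elim (h tt)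
side→-witness n (pt l x) lft  none h = level-n-witness L lft none (∉-opposite⇒≤ L h) tt (λ ())
side→-witness n (pt l x) lft  rgt  h = level-n-witness L lft rgt  (∉-opposite⇒≤ L h) tt (λ ())
side→-witness n (pt l x) rgt  none h = level-n-witness R rgt none (∉-opposite⇒≤ R h) tt (λ ())
side→-witness n (pt l x) rgt  lft  h = level-n-witness R rgt lft  (∉-opposite⇒≤ R h) tt (λ ())

-- Where the implication fails, some point above refutes it: the implication of
-- D₂∞* is the Kripke implication of the point space.
∈-imp-witness : ∀ p a b → ¬ T (p ∈ impD a b) → Witness p a b
∈-imp-witness p ⊥D      b       h = ⊥-elim (h tt)
∈-imp-witness p ⊤D      ⊥D      h = p , ≤ₚ-refl p , tt , h
∈-imp-witness p ⊤D      ⊤D      h = ⊥-elim (h tt)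
∈-imp-witness p ⊤D      (u m t) h = p , ≤ₚ-refl p , tt , h
∈-imp-witness p (u n s) ⊥D      h = ∞ , tt , tt , λ ()
∈-imp-witness p (u n s) ⊤D      h = ⊥-elim (h tt)
∈-imp-witness p (u n s) (u m t) h rewrite impD-u n s m t with cmp n m in e
... | GT = ⊥-elim (h tt)
... | EQ with refl ← cmp-EQ n m e = side→-witness n p s t h
... | LT with p
...   | ∞      = ⊥-elim (h tt)
...   | pt l x with ∉u⇒below t h
...     | inj₁ l<m         = pt m (notIn t) , inj₁ l<m , level-witness s t (cmp-LT n m e)
...     | inj₂ (refl , _)  = pt m x , ≤ₚ-refl (pt m x) , in-u-n-s , h
  where
  in-u-n-s : T (pt m x ∈ u n s)
  in-u-n-s rewrite e = tt

-- The height of an element: the number of bottom levels it depends on.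
height : D → ℕ
height (u n _) = suc n
height _       = 0

height-fullAt : ∀ n → height (fullAt n) ≤ n
height-fullAt zero    = z≤n
height-fullAt (suc n) = ≤-refl

height-side∨ : ∀ n s t → height (side∨ n s t) ≤ suc n
height-side∨ n none t    = ≤-refl
height-side∨ n lft  none = ≤-refl
height-side∨ n rgt  none = ≤-refl
height-side∨ n lft  lft  = ≤-refl
height-side∨ n rgt  rgt  = ≤-refl
height-side∨ n lft  rgt  = ≤-trans (height-fullAt n) (n≤1+n n)
height-side∨ n rgt  lft  = ≤-trans (height-fullAt n) (n≤1+n n)

height-side→ : ∀ n s t → height (side→ n s t) ≤ suc n
height-side→ n none t    = z≤n
height-side→ n lft  lft  = z≤n
height-side→ n rgt  rgt  = z≤n
height-side→ n lft  none = ≤-refl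
height-side→ n lft  rgt  = ≤-refl
height-side→ n rgt  none = ≤-refl
height-side→ n rgt  lft  = ≤-refl

height-meet : ∀ {K} a b → height a ≤ K → height b ≤ K → height (meetD a b) ≤ K
height-meet ⊥D      b       ha hb = z≤n
height-meet ⊤D      ⊥D      ha hb = z≤n
height-meet ⊤D      ⊤D      ha hb = z≤n
height-meet ⊤D      (u m t) ha hb = hb
height-meet (u n s) ⊥D      ha hb = z≤n
height-meet (u n s) ⊤D      ha hb = ha
height-meet (u n s) (u m t) ha hb rewrite meetD-u n s m t with cmp n m
... | LT = hb
... | EQ = ha
... | GT = ha

height-join : ∀ {K} a b → height a ≤ K → height b ≤ K → height (joinD a b) ≤ K
height-join ⊥D      b       ha hb = hb
height-join ⊤D      ⊥D      ha hb = z≤n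
height-join ⊤D      ⊤D      ha hb = z≤n
height-join ⊤D      (u m t) ha hb = z≤n
height-join (u n s) ⊥D      ha hb = ha
height-join (u n s) ⊤D      ha hb = z≤n
height-join (u n s) (u m t) ha hb rewrite joinD-u n s m t with cmp n m
... | LT = ha
... | EQ = ≤-trans (height-side∨ n s t) ha
... | GT = hb

height-imp : ∀ {K} a b → height a ≤ K → height b ≤ K → height (impD a b) ≤ K
height-imp ⊥D      b       ha hb = z≤n
height-imp ⊤D      ⊥D      ha hb = z≤n
height-imp ⊤D      ⊤D      ha hb = z≤n
height-imp ⊤D      (u m t) ha hb = hb
height-imp (u n s) ⊥D      ha hb = z≤n
height-imp (u n s) ⊤D      ha hb = z≤n
height-imp (u n s) (u m t) ha hb rewrite impD-u n s m t with cmp n m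
... | LT = hb
... | EQ = ≤-trans (height-side→ n s t) ha
... | GT = z≤n

∈-above-height : ∀ {K} a l x → height a ≤ K → K ≤ l → pt l x ∈ a ≡ ∞ ∈ a
∈-above-height ⊥D      l x _ _ = refl
∈-above-height ⊤D      l x _ _ = refl
∈-above-height (u n s) l x h K≤l rewrite cmp-< (<-≤-trans h K≤l) = refl

Visible : ℕ → Point → Set
Visible K ∞        = ⊤
Visible K (pt l _) = l < K

visible-witness : ∀ {K p} a b → height a ≤ K → height b ≤ K → Witness p a b →
                  ∃[ q ] Visible K q × p ≤ₚ q × T (q ∈ a) × ¬ T (q ∈ b)
visible-witness a b ha hb (∞ , p≤q , qa , qb) = ∞ , tt , p≤q , qa , qb
visible-witness {K} a b ha hb (pt l x , p≤q , qa , qb) with l <? K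
... | yes l<K = pt l x , l<K , p≤q , qa , qb
... | no  l≮K = ∞ , tt , tt , subst T (∈-above-height a l x ha (≮⇒≥ l≮K)) qa
                            , λ ∞b → qb (subst T (sym (∈-above-height b l x hb (≮⇒≥ l≮K))) ∞b)

sides-ext : ∀ s t → L ∈ˢ s ≡ L ∈ˢ t → R ∈ˢ s ≡ R ∈ˢ t → s ≡ t
sides-ext none none _  _  = refl
sides-ext lft  lft  _  _  = refl
sides-ext rgt  rgt  _  _  = refl
sides-ext none lft  () _
sides-ext none rgt  _  ()
sides-ext lft  none () _
sides-ext lft  rgt  () _
sides-ext rgt  none _  ()
sides-ext rgt  lft  _  ()

height-ext : ∀ {K} a b → height a ≤ K → height b ≤ K → (∀ q → Visible K q → q ∈ a ≡ q ∈ b) → a ≡ b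
height-ext ⊥D      ⊥D      ha hb agree = refl
height-ext ⊤D      ⊤D      ha hb agree = refl
height-ext ⊥D      ⊤D      ha hb agree with () ← agree ∞ tt
height-ext ⊥D      (u m t) ha hb agree with () ← agree ∞ tt
height-ext ⊤D      ⊥D      ha hb agree with () ← agree ∞ tt
height-ext (u n s) ⊥D      ha hb agree with () ← agree ∞ tt
height-ext ⊤D      (u m t) ha hb agree =
  ⊥-elim (notIn-∉u m t (subst T (agree (pt m (notIn t)) hb) tt))
height-ext (u n s) ⊤D      ha hb agree =
  ⊥-elim (notIn-∉u n s (subst T (sym (agree (pt n (notIn s)) ha)) tt))
height-ext (u n s) (u m t) ha hb agree with <-cmp n m
... | tri< n<m _ _ = let (in-s , out-t) = level-witness s t n<m in
                     ⊥-elim (out-t (subst T (agree (pt m (notIn t)) hb) in-s))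
... | tri> _ _ m<n = let (in-t , out-s) = level-witness t s m<n in
                     ⊥-elim (out-s (subst T (sym (agree (pt n (notIn s)) ha)) in-t))
... | tri≈ _ refl _ = cong (u n) (sides-ext s t (same-at L) (same-at R))
  where
  same-at : ∀ y → y ∈ˢ s ≡ y ∈ˢ t
  same-at y = trans (sym (∈-u-at-level n y s)) (trans (agree (pt n y) ha) (∈-u-at-level n y t))

-- Reflection of the K bottom levels, l ↦ K ∸ suc l.  Block j of the ladder goes
-- to level reflect K j: the ladder grows downwards, the levels of D₂^∞ upwards.
reflect : ℕ → ℕ → ℕ
reflect K l = K ∸ suc l

reflect-< : ∀ {K l} → l < K → reflect K l < K
reflect-< {suc K} {l} (s≤s _) = s≤s (m∸n≤m K l)

reflect-involutive : ∀ {K l} → l < K → reflect K (reflect K l) ≡ l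
reflect-involutive {suc K} (s≤s l≤K) = m∸[m∸n]≡n l≤K

reflect-antitone : ∀ {K j' j} → j' < j → j < K → reflect K j < reflect K j'
reflect-antitone j'<j j<K = ∸-monoʳ-< (s≤s j'<j) j<K

-- Comparing i with the reflection of j is comparing their sum with K - 1.
cmp-∸ : ∀ i j K → j ≤ K → cmp i (K ∸ j) ≡ cmp (i + j) K
cmp-∸ i zero    K       _         rewrite +-identityʳ i = refl
cmp-∸ i (suc j) (suc K) (s≤s j≤K) rewrite +-suc i j     = cmp-∸ i j K j≤K

cmp-reflect : ∀ {K} i j → i < K → j < K → cmp i (reflect K j) ≡ cmp j (reflect K i)
cmp-reflect {suc K} i j (s≤s i≤K) (s≤s j≤K)
  rewrite cmp-∸ i j K j≤K | cmp-∸ j i K i≤K | +-comm i j = refl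

reflect-flip : ∀ {K j l} → j < K → l < K → reflect K j < l → reflect K l < j
reflect-flip {K} {j} {l} j<K l<K r<l =
  cmp-GT j (reflect K l) (trans (sym (cmp-reflect l j l<K j<K)) (cmp-> r<l))

-- Ladder points from 2 on come in blocks of three: 2 + (3j + r) for r = 0, 1, 2.
data Pos3 : Set where
  r0 r1 r2 : Pos3

val3 : Pos3 → ℕ
val3 r0 = 0
val3 r1 = 1
val3 r2 = 2

split3 : ℕ → ℕ × Pos3
split3 zero                = 0 , r0
split3 (suc zero)          = 0 , r1
split3 (suc (suc zero))    = 0 , r2
split3 (suc (suc (suc k))) = ×.map₁ suc (split3 k)

split3-spec : ∀ j r → split3 (j * 3 + val3 r) ≡ (j , r)
split3-spec zero    r0 = refl
split3-spec zero    r1 = refl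
split3-spec zero    r2 = refl
split3-spec (suc j) r  rewrite split3-spec j r = refl

data LadderView : ℕ → Set where
  top₀  : LadderView 0
  top₁  : LadderView 1
  block : ∀ j r → LadderView (2 + (j * 3 + val3 r))

ladder-view : ∀ n → LadderView n
ladder-view zero       = top₀
ladder-view (suc zero) = top₁
ladder-view (suc (suc k)) = blocks k
  where
  blocks : ∀ k → LadderView (2 + k)
  blocks zero                = block 0 r0
  blocks (suc zero)          = block 0 r1
  blocks (suc (suc zero))    = block 0 r2
  blocks (suc (suc (suc k))) with blocks k
  ... | block j r = block (suc j) r

side3 : Pos3 → LR
side3 r0 = L
side3 r1 = R
side3 r2 = L

pos3 : LR → Pos3
pos3 L = r0
pos3 R = r1

side3-pos3 : ∀ x → side3 (pos3 x) ≡ x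
side3-pos3 L = refl
side3-pos3 R = refl

φ : ℕ → ℕ → Point
φ K zero          = ∞
φ K (suc zero)    = ∞
φ K (suc (suc k)) = pt (reflect K (proj₁ (split3 k))) (side3 (proj₂ (split3 k)))

φ-block : ∀ K j r → φ K (2 + (j * 3 + val3 r)) ≡ pt (reflect K j) (side3 r)
φ-block K j r rewrite split3-spec j r = refl

InRange : ℕ → ℕ → Set
InRange K n = n < 2 + K * 3

in-range-closed : ∀ {K n m} → InRange K n → n ⊑ m → InRange K m
in-range-closed n<R (inj₁ refl) = n<R
in-range-closed n<R (inj₂ 1+m<n) = <-trans (<-trans (n<1+n _) 1+m<n) n<R

-- The segment contains exactly the blocks j < K.  This and the following
-- arithmetic facts are proved for Boolean comparisons, whose cases compute.
block-in-range : ∀ {K} j r → InRange K (2 + (j * 3 + val3 r)) → j < K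
block-in-range {K} j r h = <ᵇ⇒< j K (by-computation j K r (<⇒<ᵇ (s<s⁻¹ (s<s⁻¹ h))))
  where
  by-computation : ∀ j K r → T (j * 3 + val3 r <ᵇ K * 3) → T (j <ᵇ K)
  by-computation zero    (suc K) r  _ = tt
  by-computation (suc j) (suc K) r  h = by-computation j K r h
  by-computation zero    zero    r0 ()
  by-computation zero    zero    r1 ()
  by-computation zero    zero    r2 ()

block-range : ∀ {K} j r → j < K → InRange K (2 + (j * 3 + val3 r))
block-range {K} j r j<K = s≤s (s≤s (<ᵇ⇒< _ _ (by-computation j K r (<⇒<ᵇ j<K))))
  where
  by-computation : ∀ j K r → T (j <ᵇ K) → T (j * 3 + val3 r <ᵇ K * 3)
  by-computation zero    (suc K) r0 _ = tt
  by-computation zero    (suc K) r1 _ = tt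
  by-computation zero    (suc K) r2 _ = tt
  by-computation (suc j) (suc K) r  h = by-computation j K r h

block-step : ∀ j' r' j r → suc (j' * 3 + val3 r') < j * 3 + val3 r → j' < j ⊎ (j' ≡ j × r' ≡ r0 × r ≡ r2)
block-step j' r' j r h = by-computation j' r' j r (<⇒<ᵇ h)
  where
  by-computation : ∀ j' r' j r → T (suc (j' * 3 + val3 r') <ᵇ j * 3 + val3 r) → j' < j ⊎ (j' ≡ j × r' ≡ r0 × r ≡ r2)
  by-computation zero     r0 zero    r2 _ = inj₂ (refl , refl , refl)
  by-computation zero     r' (suc j) r  _ = inj₁ (s≤s z≤n)
  by-computation (suc j') r' (suc j) r  h = ⊎.map s≤s (λ { (refl , e) → refl , e }) (by-computation j' r' j r h)
  by-computation zero     r0 zero    r0 ()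
  by-computation zero     r0 zero    r1 ()
  by-computation zero     r1 zero    r0 ()
  by-computation zero     r1 zero    r1 ()
  by-computation zero     r1 zero    r2 ()
  by-computation zero     r2 zero    r0 ()
  by-computation zero     r2 zero    r1 ()
  by-computation zero     r2 zero    r2 ()
  by-computation (suc j') r' zero    r0 ()
  by-computation (suc j') r' zero    r1 ()
  by-computation (suc j') r' zero    r2 ()

earlier-block : ∀ j' x j r → j' < j → suc (2 + (j' * 3 + val3 (pos3 x))) < 2 + (j * 3 + val3 r)
earlier-block j' x j r j'<j = s≤s (s≤s (<ᵇ⇒< _ _ (by-computation j' x j r (<⇒<ᵇ j'<j))))
  where
  by-computation : ∀ j' x j r → T (j' <ᵇ j) → T (suc (j' * 3 + val3 (pos3 x)) <ᵇ j * 3 + val3 r)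
  by-computation zero     L (suc j) r _ = tt
  by-computation zero     R (suc j) r _ = tt
  by-computation (suc j') x (suc j) r h = by-computation j' x j r h

φ-forth : ∀ {K n m} → InRange K n → n ⊑ m → φ K n ≤ₚ φ K m
φ-forth {K} {n} {m} _ (inj₁ refl) = ≤ₚ-refl (φ K n)
φ-forth {K} {n} {m} n∈R (inj₂ 1+m<n) with ladder-view m | ladder-view n
... | top₀       | _         = tt
... | top₁       | _         = tt
... | block _ _  | top₀      with () ← 1+m<n
... | block _ _  | top₁      with s≤s () ← 1+m<n
... | block j' r' | block j r =
  subst₂ _≤ₚ_ (sym (φ-block K j r)) (sym (φ-block K j' r'))
    (images (block-step j' r' j r (s<s⁻¹ (s<s⁻¹ 1+m<n))))
  where
  images : j' < j ⊎ (j' ≡ j × r' ≡ r0 × r ≡ r2) → pt (reflect K j) (side3 r) ≤ₚ pt (reflect K j') (side3 r')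
  images (inj₁ j'<j)                = inj₁ (reflect-antitone j'<j (block-in-range {K} j r n∈R))
  images (inj₂ (refl , refl , refl)) = inj₂ (refl , refl)

φ-back : ∀ {K n q} → InRange K n → φ K n ≤ₚ q → Visible K q → ∃[ m ] n ⊑ m × φ K m ≡ q
φ-back {K} {n} {∞} _ _ _ with ladder-view n
... | top₀      = 0 , inj₁ refl , refl
... | top₁      = 1 , inj₁ refl , refl
... | block j r = 0 , inj₂ (s≤s (s≤s z≤n)) , refl
φ-back {K} {n} {pt l x} n∈R le l<K with ladder-view n
... | block j r with subst (_≤ₚ pt l x) (φ-block K j r) le
...   | inj₂ (refl , refl) = n , inj₁ refl , φ-block K j r
...   | inj₁ r<l =
  2 + (reflect K l * 3 + val3 (pos3 x)) ,
  inj₂ (earlier-block (reflect K l) x j r (reflect-flip (block-in-range {K} j r n∈R) l<K r<l)) ,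
  trans (φ-block K (reflect K l) (pos3 x)) (cong₂ pt (reflect-involutive l<K) (side3-pos3 x))

φ-onto : ∀ {K} q → Visible K q → ∃[ n ] InRange K n × φ K n ≡ q
φ-onto ∞        _   = 0 , s≤s z≤n , refl
φ-onto {K} (pt l x) l<K =
  2 + (reflect K l * 3 + val3 (pos3 x)) ,
  block-range (reflect K l) (pos3 x) (reflect-< l<K) ,
  trans (φ-block K (reflect K l) (pos3 x)) (cong₂ pt (reflect-involutive l<K) (side3-pos3 x))

-- Terms defining, on the ladder, the preimages of the generators u i s:
-- with d = reflect K i, the part s of level i is block d (sides by side3).
defining-set : Side → ℕ → ℕ → Bool
defining-set none d n = n <ᵇ 2 + d * 3
defining-set lft  d n = (n <ᵇ 3 + d * 3) ∨ (n ≡ᵇ 4 + d * 3)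
defining-set rgt  d n = (n <ᵇ 2 + d * 3) ∨ (n ≡ᵇ 3 + d * 3)

defining : Side → ℕ → Term ⊤
defining none d = below (2 + d * 3)
defining lft  d = gap (3 + d * 3)
defining rgt  d = gap (2 + d * 3)

sat-defining : ∀ s d n → sat n (defining s d) ≡ defining-set s d n
sat-defining none d = sat-below (2 + d * 3)
sat-defining lft  d = sat-gap (3 + d * 3)
sat-defining rgt  d = sat-gap (2 + d * 3)

defining-top₀ : ∀ s d → defining-set s d 0 ≡ true
defining-top₀ none d = refl
defining-top₀ lft  d = refl
defining-top₀ rgt  d = refl

defining-top₁ : ∀ s d → defining-set s d 1 ≡ true
defining-top₁ none d = refl
defining-top₁ lft  d = refl
defining-top₁ rgt  d = refl

defining-block : ∀ s j d r → defining-set s d (2 + (j * 3 + val3 r)) ≡ by-cmp (cmp j d) true (side3 r ∈ˢ s) false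
defining-block none (suc j) (suc d) r  = defining-block none j d r
defining-block none (suc j) zero    r  = refl
defining-block none zero    (suc d) r0 = refl
defining-block none zero    (suc d) r1 = refl
defining-block none zero    (suc d) r2 = refl
defining-block none zero    zero    r0 = refl
defining-block none zero    zero    r1 = refl
defining-block none zero    zero    r2 = refl
defining-block lft  (suc j) (suc d) r  = defining-block lft j d r
defining-block lft  (suc j) zero    r  = refl
defining-block lft  zero    (suc d) r0 = refl
defining-block lft  zero    (suc d) r1 = refl
defining-block lft  zero    (suc d) r2 = refl
defining-block lft  zero    zero    r0 = refl
defining-block lft  zero    zero    r1 = refl
defining-block lft  zero    zero    r2 = refl
defining-block rgt  (suc j) (suc d) r  = defining-block rgt j d r
defining-block rgt  (suc j) zero    r  = refl
defining-block rgt  zero    (suc d) r0 = refl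
defining-block rgt  zero    (suc d) r1 = refl
defining-block rgt  zero    (suc d) r2 = refl
defining-block rgt  zero    zero    r0 = refl
defining-block rgt  zero    zero    r1 = refl
defining-block rgt  zero    zero    r2 = refl

τ : ℕ → D → Term ⊤
τ K ⊥D      = 0ₜ
τ K ⊤D      = 1ₜ
τ K (u i s) = defining s (reflect K i)

τ-spec : ∀ K a n → height a ≤ K → InRange K n → sat n (τ K a) ≡ φ K n ∈ a
τ-spec K ⊥D      n _ _ = refl
τ-spec K ⊤D      n _ _ = refl
τ-spec K (u i s) n i<K n∈R with ladder-view n
... | top₀      = trans (sat-defining s (reflect K i) 0) (defining-top₀ s (reflect K i))
... | top₁      = trans (sat-defining s (reflect K i) 1) (defining-top₁ s (reflect K i))
... | block j r = begin
  sat (2 + (j * 3 + val3 r)) (defining s (reflect K i))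
    ≡⟨ sat-defining s (reflect K i) _ ⟩
  defining-set s (reflect K i) (2 + (j * 3 + val3 r))
    ≡⟨ defining-block s j (reflect K i) r ⟩
  by-cmp (cmp j (reflect K i)) true (side3 r ∈ˢ s) false
    ≡⟨ cong (λ c → by-cmp c true (side3 r ∈ˢ s) false) (cmp-reflect i j i<K (block-in-range {K} j r n∈R)) ⟨
  pt (reflect K j) (side3 r) ∈ u i s
    ≡⟨ cong (_∈ u i s) (φ-block K j r) ⟨
  φ K (2 + (j * 3 + val3 r)) ∈ u i s ∎
  where open ≡-Reasoning

open DecidableFrame ladder using (every; every-⇒-intro; every-⇒-elim)

φ-imp : ∀ {K} a b n → height a ≤ K → height b ≤ K → InRange K n →
        φ K n ∈ impD a b ≡ every n (λ m → (φ K m ∈ a) ⇒ (φ K m ∈ b))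
φ-imp {K} a b n ha hb n∈R = T-ext
  (λ h → every-⇒-intro (λ m → φ K m ∈ a) (λ m → φ K m ∈ b) λ n⊑m →
           ∈-imp-elim (φ K _) a b (∈-upset (impD a b) (φ-forth n∈R n⊑m) h))
  (λ h → decidable-stable (T? (φ K n ∈ impD a b)) λ n∉ →
     let (q , q-visible , n≤q , qa , qb) = visible-witness a b ha hb (∈-imp-witness (φ K n) a b n∉)
         (m , n⊑m , φm≡q) = φ-back n∈R n≤q q-visible
     in qb (subst (λ p → T (p ∈ b)) φm≡q
              (every-⇒-elim (λ m → φ K m ∈ a) (λ m → φ K m ∈ b) h n⊑m
                (subst (λ p → T (p ∈ a)) (sym φm≡q) qa))))

module Evaluation (ρ : ℕ → D) where

  ⟦_⟧ : Term ℕ → D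
  ⟦_⟧ = HAlg.eval D₂∞* ρ

  ⟦_⟧ᴿᴺ : Term ℕ → ℕ → Term ⊤
  ⟦ s ⟧ᴿᴺ K = HAlg.eval RN (λ x → τ K (ρ x)) s

  vars-bound : Term ℕ → ℕ
  vars-bound (var x)  = height (ρ x)
  vars-bound 0ₜ       = 0
  vars-bound 1ₜ       = 0
  vars-bound (a ∧ₜ b) = vars-bound a ⊔ vars-bound b
  vars-bound (a ∨ₜ b) = vars-bound a ⊔ vars-bound b
  vars-bound (a →ₜ b) = vars-bound a ⊔ vars-bound b

  height-eval : ∀ {K} s → vars-bound s ≤ K → height ⟦ s ⟧ ≤ K
  height-eval (var x)  h = h
  height-eval 0ₜ       h = z≤n
  height-eval 1ₜ       h = z≤n
  height-eval (a ∧ₜ b) h = height-meet ⟦ a ⟧ ⟦ b ⟧ (height-eval a (m⊔n≤o⇒m≤o _ _ h)) (height-eval b (m⊔n≤o⇒n≤o _ _ h))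
  height-eval (a ∨ₜ b) h = height-join ⟦ a ⟧ ⟦ b ⟧ (height-eval a (m⊔n≤o⇒m≤o _ _ h)) (height-eval b (m⊔n≤o⇒n≤o _ _ h))
  height-eval (a →ₜ b) h = height-imp  ⟦ a ⟧ ⟦ b ⟧ (height-eval a (m⊔n≤o⇒m≤o _ _ h)) (height-eval b (m⊔n≤o⇒n≤o _ _ h))

  transfer : ∀ {K} s → vars-bound s ≤ K → ∀ n → InRange K n → sat n (⟦ s ⟧ᴿᴺ K) ≡ φ K n ∈ ⟦ s ⟧
  transfer {K} (var x)  h n n∈R = τ-spec K (ρ x) n h n∈R
  transfer     0ₜ       h n n∈R = refl
  transfer     1ₜ       h n n∈R = refl
  transfer {K} (a ∧ₜ b) h n n∈R =
    trans (cong₂ _∧_ (transfer a (m⊔n≤o⇒m≤o _ _ h) n n∈R) (transfer b (m⊔n≤o⇒n≤o _ _ h) n n∈R))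
          (sym (∈-meet (φ K n) ⟦ a ⟧ ⟦ b ⟧))
  transfer {K} (a ∨ₜ b) h n n∈R =
    trans (cong₂ _∨_ (transfer a (m⊔n≤o⇒m≤o _ _ h) n n∈R) (transfer b (m⊔n≤o⇒n≤o _ _ h) n n∈R))
          (sym (∈-join (φ K n) ⟦ a ⟧ ⟦ b ⟧))
  transfer {K} (a →ₜ b) h n n∈R =
    trans (every-cong _ _ λ {m} n⊑m → cong₂ _⇒_ (transfer a ha m (in-range-closed {K} n∈R n⊑m))
                                                 (transfer b hb m (in-range-closed {K} n∈R n⊑m)))
          (sym (φ-imp ⟦ a ⟧ ⟦ b ⟧ n (height-eval a ha) (height-eval b hb) n∈R))
    where
    ha : vars-bound a ≤ K
    ha = m⊔n≤o⇒m≤o (vars-bound a) (vars-bound b) h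
    hb : vars-bound b ≤ K
    hb = m⊔n≤o⇒n≤o (vars-bound a) (vars-bound b) h

lemma8p1 : D₂∞* ∈𝕍 RN
lemma8p1 s t RN⊨s≈t ρ = height-ext ⟦ s ⟧ ⟦ t ⟧ (height-eval s Ks) (height-eval t Kt) agree
  where
  open Evaluation ρ
  K : ℕ
  K = vars-bound s ⊔ vars-bound t
  Ks : vars-bound s ≤ K
  Ks = m≤m⊔n (vars-bound s) (vars-bound t)
  Kt : vars-bound t ≤ K
  Kt = m≤n⊔m (vars-bound s) (vars-bound t)
  agree : ∀ q → Visible K q → q ∈ ⟦ s ⟧ ≡ q ∈ ⟦ t ⟧
  agree q q-visible with φ-onto q q-visible
  ... | n , n∈R , refl = begin
    φ K n ∈ ⟦ s ⟧       ≡⟨ transfer s Ks n n∈R ⟨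
    sat n (⟦ s ⟧ᴿᴺ K)   ≡⟨ sound (RN⊨s≈t (λ x → τ K (ρ x))) n ⟩
    sat n (⟦ t ⟧ᴿᴺ K)   ≡⟨ transfer t Kt n n∈R ⟩
    φ K n ∈ ⟦ t ⟧       ∎
    where open ≡-Reasoning
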